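{- Let $q\in\mathbb{C}$ with $0<|q|<1$. Let $B_{n,k}(1,-q)$ ($n\ge k\ge0$) be the unique complex numbers such that for every integer $k\ge0$, $$z^k=\sum_{n=k}^\infty B_{n,k}(1,-q)\,z^n\frac{(z;q)_n}{(-zq;q)_n}\quad\text{in }\mathbb{C}[[z]].$$ Then for every integer $n\ge0$, $$\sum_{k=0}^{\lfloor n/2\rfloor}B_{n,2k}(1,-q)(-1)^kq^{k^2}+\sum_{k=0}^{\lfloor (n-1)/2\rfloor}B_{n,2k+1}(1,-q)(-1)^kq^{k^2}=1,$$ where $\lfloor x\rfloor$ is the floor function (and the second sum is empty for $n=0$).
   Context: $(x;q)_n=\prod_{i=0}^{n-1}(1-xq^i)$ for $n\ge0$, with $(x;q)_0=1$; quotients $(z;q)_n/(-zq;q)_n$ are expanded as formal power series in $z$. -}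

module Defs where

open import Level using (_⊔_)
open import Algebra.Bundles using (CommutativeRing)
open import Data.Nat using (ℕ; zero; suc; _∸_; ⌊_/2⌋; ⌈_/2⌉)
  renaming (_*_ to _*ℕ_; _+_ to _+ℕ_)
open import Data.Bool using (if_then_else_)
open import Relation.Nullary.Decidable using (⌊_⌋)

-- Everything is parameterised by a commutative ring R (the coefficient ring
-- of the formal power series; the paper uses R = ℂ).
module _ {c ℓ} (R : CommutativeRing c ℓ) where
  open CommutativeRing R

  pow : Carrier → ℕ → Carrier
  pow x zero    = 1#
  pow x (suc n) = pow x n * x

  sumTo : ℕ → (ℕ → Carrier) → Carrier
  sumTo zero    f = 0#
  sumTo (suc n) f = sumTo n f + f n

  Series : Set c
  Series = ℕ → Carrier

  _⊛_ : Series → Series → Series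
  (f ⊛ g) m = sumTo (suc m) (λ i → f i * g (m ∸ i))

  onePlus : Carrier → Series
  onePlus a zero          = 1#
  onePlus a (suc zero)    = a
  onePlus a (suc (suc _)) = 0#

  -- the formal inverse (1 + a z)^{-1} = Σ_j (-a)^j z^j in R[[z]]
  invOnePlus : Carrier → Series
  invOnePlus a j = pow (- a) j

  -- F n = (z;q)_n / (-zq;q)_n  as a formal power series in z:
  -- F 0 = 1,  F (n+1) = F n · (1 - q^n z) · (1 + q^(n+1) z)^{-1}
  qQuot : Carrier → ℕ → Series
  qQuot q zero    zero    = 1#
  qQuot q zero    (suc _) = 0#
  qQuot q (suc n) = (qQuot q n ⊛ onePlus (- pow q n)) ⊛ invOnePlus (pow q (suc n))

  δ : ℕ → ℕ → Carrier
  δ m k = if ⌊ m Data.Nat.≟ k ⌋ then 1# else 0#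

  -- B satisfies, for every k ≥ 0,
  --   z^k = Σ_{n ≥ k} B n k · z^n · (z;q)_n/(-zq;q)_n   in R[[z]],
  -- compared coefficientwise: the coefficient of z^m on the right is
  --   Σ_{n = k}^{m} B n k · [z^(m-n)] ((z;q)_n/(-zq;q)_n).
  IsBExpansion : Carrier → (ℕ → ℕ → Carrier) → Set ℓ
  IsBExpansion q B = ∀ (k m : ℕ) →
    δ m k ≈ sumTo (suc m ∸ k) (λ i → B (k +ℕ i) k * qQuot q (k +ℕ i) (m ∸ (k +ℕ i)))

  -- LHS of Corollary 3.5:
  --   Σ_{k=0}^{⌊n/2⌋} B n (2k) (-1)^k q^{k²} + Σ_{k=0}^{⌊(n-1)/2⌋} B n (2k+1) (-1)^k q^{k²}
  -- the second sum has ⌈n/2⌉ terms (empty for n = 0).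
  corLHS : Carrier → (ℕ → ℕ → Carrier) → ℕ → Carrier
  corLHS q B n =
      sumTo (suc ⌊ n /2⌋) (λ k → B n (2 *ℕ k) * (pow (- 1#) k * pow q (k *ℕ k)))
    + sumTo ⌈ n /2⌉ (λ k → B n (suc (2 *ℕ k)) * (pow (- 1#) k * pow q (k *ℕ k)))

module Submission where

open import Defs
open import Level using (Level)
open import Data.Nat using (ℕ)
open import Algebra.Bundles using (CommutativeRing)

open import Algebra.Bundles using (RawRing)
open import Algebra.Solver.Ring.AlmostCommutativeRing
  using (_-Raw-AlmostCommutative⟶_; fromCommutativeRing)
open import Data.Bool using (if_then_else_)
open import Data.Integer as ℤ using (ℤ; +_; -[1+_]; ∣_∣; sign; _◃_; _⊖_)
import Data.Integer.Properties as ℤP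
open import Data.Maybe using (Maybe; just; nothing)
open import Data.Nat as ℕ using (zero; suc; _∸_; _<_; _≤_; s≤s; ⌊_/2⌋; ⌈_/2⌉)
import Data.Nat.Properties as ℕP
open import Data.Nat.Tactic.RingSolver using (solve-∀)
open import Data.Sign as Sign using (Sign)
open import Data.Sum using (inj₁; inj₂)
open import Relation.Binary.Bundles using (Setoid)
import Relation.Binary.Reasoning.Setoid as SetoidReasoning
open import Relation.Binary.PropositionalEquality as P using (_≡_)
open import Relation.Nullary using (yes; no)
open import Relation.Nullary.Decidable using (isYes≗does; dec-true; dec-false)

-- Write F n = (z;q)_n/(-zq;q)_n and C = Σ_m (-1)^⌊m/2⌋ q^(⌊m/2⌋²) z^m.  The
-- heart of the proof is the identity of formal power series
--   G := Σ_n z^n F n = C,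
-- proved by showing that both sides solve the functional equation
--   (1 + q z) f(z) + q z² (1 + z) f(qz) = (1 + z)(1 + q z),
-- whose solution is unique since the operator on the left is unitriangular.
-- For G this is a telescoping sum, driven by the two recurrences
--   (1 + q^(n+1) z) F (n+1) = (1 - q^n z) F n   and   (1 + q z) F (n+1) = (1 - z) F n (qz);
-- for C it is the recurrence  e (k+1) = - q^(2k+1) e k  of  e k = (-1)^k q^(k²).
-- Substituting the expansions of the monomials z^k into C then shows that
-- u n = Σ_k B n k C k  and the constant sequence 1 solve the same
-- unitriangular system  Σ_n u n z^n F n = C,  so u n = 1; splitting u n by
-- parity of k gives the statement.

double-suc : ∀ i → 2 ℕ.* suc i ≡ suc (suc (2 ℕ.* i))
double-suc i = P.cong suc (ℕP.+-suc i (i ℕ.+ 0))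

square-suc : ∀ i → suc i ℕ.* suc i ≡ i ℕ.* i ℕ.+ suc (2 ℕ.* i)
square-suc = solve-∀

half-double : ∀ i → ⌊ 2 ℕ.* i /2⌋ ≡ i
half-double zero = P.refl
half-double (suc i) = P.trans (P.cong ⌊_/2⌋ (double-suc i)) (P.cong suc (half-double i))

half-suc-double : ∀ i → ⌊ suc (2 ℕ.* i) /2⌋ ≡ i
half-suc-double zero = P.refl
half-suc-double (suc i) =
  P.trans (P.cong (λ n → ⌊ suc n /2⌋) (double-suc i)) (P.cong suc (half-suc-double i))

data EvenOdd : ℕ → Set where
  even : ∀ i → EvenOdd (2 ℕ.* i)
  odd  : ∀ i → EvenOdd (suc (2 ℕ.* i))

evenOdd : ∀ n → EvenOdd n
evenOdd zero = even 0
evenOdd (suc n) with evenOdd n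
... | even i = odd i
... | odd i  = P.subst EvenOdd (double-suc i) (even (suc i))

-- The ring solver of the standard library normalises polynomials over a
-- coefficient ring that maps homomorphically into the target ring.  For an
-- arbitrary commutative ring the natural choice is ℤ with its canonical map.
module IntegerCoefficients {c ℓ} (R : CommutativeRing c ℓ) where
  open CommutativeRing R
  open import Relation.Binary.Reasoning.Setoid setoid
  open import Algebra.Properties.Monoid.Mult.TCOptimised +-monoid using (_×_; ×-homo-+; 1+×)
  open import Algebra.Properties.Semiring.Mult.TCOptimised semiring using (×1-homo-*)
  open import Algebra.Properties.Ring ring
    using (-‿distribˡ-*; -‿distribʳ-*; -‿involutive; -0#≈0#; -‿anti-homo-+)
  open import Algebra.Properties.AbelianGroup +-abelianGroup using (⁻¹-∙-comm)

  ⟦_⟧ℤ : ℤ → Carrier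
  ⟦ + n ⟧ℤ      = n × 1#
  ⟦ -[1+ n ] ⟧ℤ = - (suc n × 1#)

  -- ⟦_⟧ℤ is a ring homomorphism; products are handled through sign and
  -- absolute value, sums through the subtraction  m ⊖ n  of naturals.
  signed : Sign → Carrier → Carrier
  signed Sign.+ x = x
  signed Sign.- x = - x

  signed-cong : ∀ s {x y} → x ≈ y → signed s x ≈ signed s y
  signed-cong Sign.+ x≈y = x≈y
  signed-cong Sign.- x≈y = -‿cong x≈y

  signed-* : ∀ s t x y → signed (s Sign.* t) (x * y) ≈ signed s x * signed t y
  signed-* Sign.+ Sign.+ x y = refl
  signed-* Sign.+ Sign.- x y = -‿distribʳ-* x y
  signed-* Sign.- Sign.+ x y = -‿distribˡ-* x y
  signed-* Sign.- Sign.- x y = begin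
    x * y           ≈⟨ *-cong (-‿involutive x) refl ⟨
    (- - x) * y     ≈⟨ -‿distribˡ-* (- x) y ⟨
    - (- x * y)     ≈⟨ -‿distribʳ-* (- x) y ⟩
    (- x) * (- y)   ∎

  ⟦◃⟧ : ∀ s n → ⟦ s ◃ n ⟧ℤ ≈ signed s (n × 1#)
  ⟦◃⟧ Sign.+ zero    = refl
  ⟦◃⟧ Sign.- zero    = sym -0#≈0#
  ⟦◃⟧ Sign.+ (suc n) = refl
  ⟦◃⟧ Sign.- (suc n) = refl

  ⟦sign-abs⟧ : ∀ i → ⟦ i ⟧ℤ ≈ signed (sign i) (∣ i ∣ × 1#)
  ⟦sign-abs⟧ (+ n)    = refl
  ⟦sign-abs⟧ -[1+ n ] = refl

  ⟦⊖⟧ : ∀ m n → ⟦ m ⊖ n ⟧ℤ ≈ m × 1# - n × 1#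
  ⟦⊖⟧ zero    zero    = sym (-‿inverseʳ 0#)
  ⟦⊖⟧ zero    (suc n) = sym (+-identityˡ _)
  ⟦⊖⟧ (suc m) zero    = sym (trans (+-cong refl -0#≈0#) (+-identityʳ _))
  ⟦⊖⟧ (suc m) (suc n) = begin
    ⟦ suc m ⊖ suc n ⟧ℤ                  ≡⟨ P.cong ⟦_⟧ℤ (ℤP.[1+m]⊖[1+n]≡m⊖n m n) ⟩
    ⟦ m ⊖ n ⟧ℤ                          ≈⟨ ⟦⊖⟧ m n ⟩
    m × 1# - n × 1#                     ≈⟨ cancel-1 (m × 1#) (n × 1#) ⟨
    (1# + m × 1#) - (1# + n × 1#)       ≈⟨ +-cong (1+× m 1#) (-‿cong (1+× n 1#)) ⟨
    suc m × 1# - suc n × 1#             ∎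
    where
    cancel-1 : ∀ a b → (1# + a) - (1# + b) ≈ a - b
    cancel-1 a b = begin
      (1# + a) - (1# + b)       ≈⟨ +-cong refl (-‿anti-homo-+ 1# b) ⟩
      (1# + a) + (- b + - 1#)   ≈⟨ +-cong (+-comm 1# a) refl ⟩
      (a + 1#) + (- b + - 1#)   ≈⟨ +-assoc a 1# _ ⟩
      a + (1# + (- b + - 1#))   ≈⟨ +-cong refl (+-cong refl (+-comm (- b) (- 1#))) ⟩
      a + (1# + (- 1# + - b))   ≈⟨ +-cong refl (+-assoc 1# (- 1#) (- b)) ⟨
      a + ((1# - 1#) + - b)     ≈⟨ +-cong refl (+-cong (-‿inverseʳ 1#) refl) ⟩
      a + (0# + - b)            ≈⟨ +-cong refl (+-identityˡ (- b)) ⟩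
      a - b                     ∎

  ⟦+⟧ : ∀ i j → ⟦ i ℤ.+ j ⟧ℤ ≈ ⟦ i ⟧ℤ + ⟦ j ⟧ℤ
  ⟦+⟧ (+ m)    (+ n)    = ×-homo-+ 1# m n
  ⟦+⟧ (+ m)    -[1+ n ] = ⟦⊖⟧ m (suc n)
  ⟦+⟧ -[1+ m ] (+ n)    = trans (⟦⊖⟧ n (suc m)) (+-comm _ _)
  ⟦+⟧ -[1+ m ] -[1+ n ] = begin
    - (suc (suc (m ℕ.+ n)) × 1#)        ≡⟨ P.cong (λ k → - (k × 1#)) (ℕP.+-suc (suc m) n) ⟨
    - ((suc m ℕ.+ suc n) × 1#)          ≈⟨ -‿cong (×-homo-+ 1# (suc m) (suc n)) ⟩
    - (suc m × 1# + suc n × 1#)         ≈⟨ ⁻¹-∙-comm _ _ ⟨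
    ⟦ -[1+ m ] ⟧ℤ + ⟦ -[1+ n ] ⟧ℤ       ∎

  ⟦*⟧ : ∀ i j → ⟦ i ℤ.* j ⟧ℤ ≈ ⟦ i ⟧ℤ * ⟦ j ⟧ℤ
  ⟦*⟧ i j = begin
    ⟦ (sign i Sign.* sign j) ◃ (∣ i ∣ ℕ.* ∣ j ∣) ⟧ℤ
      ≈⟨ ⟦◃⟧ (sign i Sign.* sign j) (∣ i ∣ ℕ.* ∣ j ∣) ⟩
    signed (sign i Sign.* sign j) ((∣ i ∣ ℕ.* ∣ j ∣) × 1#)
      ≈⟨ signed-cong (sign i Sign.* sign j) (×1-homo-* ∣ i ∣ ∣ j ∣) ⟩
    signed (sign i Sign.* sign j) ((∣ i ∣ × 1#) * (∣ j ∣ × 1#))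
      ≈⟨ signed-* (sign i) (sign j) _ _ ⟩
    signed (sign i) (∣ i ∣ × 1#) * signed (sign j) (∣ j ∣ × 1#)
      ≈⟨ *-cong (⟦sign-abs⟧ i) (⟦sign-abs⟧ j) ⟨
    ⟦ i ⟧ℤ * ⟦ j ⟧ℤ ∎

  ⟦-⟧ : ∀ i → ⟦ ℤ.- i ⟧ℤ ≈ - ⟦ i ⟧ℤ
  ⟦-⟧ (+ zero)  = sym -0#≈0#
  ⟦-⟧ (+ suc n) = refl
  ⟦-⟧ -[1+ n ]  = sym (-‿involutive _)

  ℤ-rawRing : RawRing _ _
  ℤ-rawRing = record
    { Carrier = ℤ ; _≈_ = _≡_ ; _+_ = ℤ._+_ ; _*_ = ℤ._*_ ; -_ = ℤ.-_ ; 0# = + 0 ; 1# = + 1 }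

  ℤ⟶R : ℤ-rawRing -Raw-AlmostCommutative⟶ fromCommutativeRing R
  ℤ⟶R = record
    { ⟦_⟧ = ⟦_⟧ℤ ; +-homo = ⟦+⟧ ; *-homo = ⟦*⟧ ; -‿homo = ⟦-⟧ ; 0-homo = refl ; 1-homo = refl }

  ⟦≟⟧ : ∀ i j → Maybe (⟦ i ⟧ℤ ≈ ⟦ j ⟧ℤ)
  ⟦≟⟧ i j with i ℤ.≟ j
  ... | yes P.refl = just refl
  ... | no _       = nothing

  open import Algebra.Solver.Ring ℤ-rawRing (fromCommutativeRing R) ℤ⟶R ⟦≟⟧ public

module _ {c ℓ} (R : CommutativeRing c ℓ) where
  open CommutativeRing R hiding (zero)
  open import Algebra.Properties.Ring ring using (-‿distribˡ-*)
  open import Algebra.Properties.AbelianGroup +-abelianGroup using (∙-cancelˡ; ∙-cancelʳ)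
  open IntegerCoefficients R using (solve; _:+_; _:*_; :-_; _:-_; _:=_; con)
  module ≈-Reasoning = SetoidReasoning setoid

  +-cancelʳ : ∀ {x x′ y y′} → x + y ≈ x′ + y′ → y ≈ y′ → x ≈ x′
  +-cancelʳ {x} {x′} eq y≈y′ = ∙-cancelʳ _ x x′ (trans (+-cong refl (sym y≈y′)) eq)

  +-cancelˡ : ∀ {x x′ y y′} → y + x ≈ y′ + x′ → y ≈ y′ → x ≈ x′
  +-cancelˡ {x} {x′} eq y≈y′ = ∙-cancelˡ _ x x′ (trans (+-cong (sym y≈y′) refl) eq)

  sum-cong : ∀ n {f g : ℕ → Carrier} → (∀ i → i < n → f i ≈ g i) → sumTo R n f ≈ sumTo R n g
  sum-cong zero    f≈g = refl
  sum-cong (suc n) f≈g =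
    +-cong (sum-cong n (λ i i<n → f≈g i (ℕP.m<n⇒m<1+n i<n))) (f≈g n (ℕP.n<1+n n))

  sum-zero : ∀ n {f : ℕ → Carrier} → (∀ i → i < n → f i ≈ 0#) → sumTo R n f ≈ 0#
  sum-zero zero    f≈0 = refl
  sum-zero (suc n) f≈0 =
    trans (+-cong (sum-zero n (λ i i<n → f≈0 i (ℕP.m<n⇒m<1+n i<n))) (f≈0 n (ℕP.n<1+n n)))
          (+-identityʳ 0#)

  sum-*ʳ : ∀ n (f : ℕ → Carrier) x → sumTo R n f * x ≈ sumTo R n (λ i → f i * x)
  sum-*ʳ zero    f x = zeroˡ x
  sum-*ʳ (suc n) f x = trans (distribʳ x _ _) (+-cong (sum-*ʳ n f x) refl)

  sum-+ : ∀ n (f g : ℕ → Carrier) → sumTo R n (λ i → f i + g i) ≈ sumTo R n f + sumTo R n g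
  sum-+ zero    f g = sym (+-identityʳ 0#)
  sum-+ (suc n) f g = trans (+-cong (sum-+ n f g) refl)
    (solve 4 (λ a b x y → (a :+ b) :+ (x :+ y) := (a :+ x) :+ (b :+ y)) refl _ _ (f n) (g n))

  -- Interchanging the order of summation over the triangle  k ≤ n < N;
  -- the right-hand side is the shape of the sums in  IsBExpansion.
  sum-triangle : ∀ N (a : ℕ → ℕ → Carrier) →
    sumTo R N (λ n → sumTo R (suc n) (a n)) ≈ sumTo R N (λ k → sumTo R (N ∸ k) (λ i → a (k ℕ.+ i) k))
  sum-triangle zero    a = refl
  sum-triangle (suc N) a = begin
    sumTo R N (λ n → sumTo R (suc n) (a n)) + sumTo R (suc N) (a N)
      ≈⟨ +-cong (sum-triangle N a) refl ⟩
    sumTo R N column + sumTo R (suc N) (a N)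
      ≈⟨ +-cong (trans (+-cong refl column-N) (+-identityʳ _)) refl ⟨
    sumTo R (suc N) column + sumTo R (suc N) (a N)
      ≈⟨ sum-+ (suc N) column (a N) ⟨
    sumTo R (suc N) (λ k → column k + a N k)
      ≈⟨ sum-cong (suc N) (λ k k<1+N → extend-column (ℕP.≤-pred k<1+N)) ⟩
    sumTo R (suc N) (λ k → sumTo R (suc N ∸ k) (λ i → a (k ℕ.+ i) k)) ∎
    where
    open ≈-Reasoning
    column : ℕ → Carrier
    column k = sumTo R (N ∸ k) (λ i → a (k ℕ.+ i) k)
    column-N : column N ≈ 0#
    column-N = reflexive (P.cong (λ t → sumTo R t (λ i → a (N ℕ.+ i) N)) (ℕP.n∸n≡0 N))
    extend-column : ∀ {k} → k ≤ N → column k + a N k ≈ sumTo R (suc N ∸ k) (λ i → a (k ℕ.+ i) k)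
    extend-column {k} k≤N = sym (trans
      (reflexive (P.cong (λ t → sumTo R t (λ i → a (k ℕ.+ i) k)) (ℕP.+-∸-assoc 1 k≤N)))
      (+-cong refl (reflexive (P.cong (λ t → a t k) (ℕP.m+[n∸m]≡n k≤N)))))

  sum-δ : ∀ m (x : ℕ → Carrier) → sumTo R (suc m) (λ k → δ R m k * x k) ≈ x m
  sum-δ m x = begin
    sumTo R m (λ k → δ R m k * x k) + δ R m m * x m
      ≈⟨ +-cong (sum-zero m (λ k k<m → trans (*-cong (δ-off k<m) refl) (zeroˡ _)))
                (*-cong δ-diagonal refl) ⟩
    0# + 1# * x m
      ≈⟨ trans (+-identityˡ _) (*-identityˡ _) ⟩
    x m ∎
    where
    open ≈-Reasoning
    δ-diagonal : δ R m m ≈ 1#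
    δ-diagonal = reflexive (P.cong (λ b → if b then 1# else 0#)
      (P.trans (isYes≗does (m ℕ.≟ m)) (dec-true (m ℕ.≟ m) P.refl)))
    δ-off : ∀ {k} → k < m → δ R m k ≈ 0#
    δ-off {k} k<m = reflexive (P.cong (λ b → if b then 1# else 0#)
      (P.trans (isYes≗does (m ℕ.≟ k)) (dec-false (m ℕ.≟ k) (λ m≡k → ℕP.<-irrefl (P.sym m≡k) k<m))))

  module _ (g : ℕ → Carrier) where
    evens odds : ℕ → Carrier
    evens j = sumTo R j (λ k → g (2 ℕ.* k))
    odds  j = sumTo R j (λ k → g (suc (2 ℕ.* k)))

    sum-to-even : ∀ i → sumTo R (suc (2 ℕ.* i)) g ≈ evens (suc i) + odds i
    sum-to-odd  : ∀ i → sumTo R (suc (suc (2 ℕ.* i))) g ≈ evens (suc i) + odds (suc i)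
    sum-to-even zero    = sym (+-identityʳ _)
    sum-to-even (suc i) = begin
      sumTo R (suc (2 ℕ.* suc i)) g
        ≡⟨ P.cong (λ t → sumTo R (suc t) g) (double-suc i) ⟩
      sumTo R (suc (suc (2 ℕ.* i))) g + g (suc (suc (2 ℕ.* i)))
        ≈⟨ +-cong (sum-to-odd i) (reflexive (P.cong g (P.sym (double-suc i)))) ⟩
      (evens (suc i) + odds (suc i)) + g (2 ℕ.* suc i)
        ≈⟨ solve 3 (λ e o x → (e :+ o) :+ x := (e :+ x) :+ o) refl _ _ _ ⟩
      evens (suc (suc i)) + odds (suc i) ∎
      where open ≈-Reasoning
    sum-to-odd i = trans (+-cong (sum-to-even i) refl) (+-assoc _ _ _)

  sum-even-odd : ∀ n (g : ℕ → Carrier) → sumTo R (suc n) g ≈ evens g (suc ⌊ n /2⌋) + odds g ⌈ n /2⌉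
  sum-even-odd n g with evenOdd n
  ... | even i rewrite half-double i | half-suc-double i = sum-to-even g i
  ... | odd i  rewrite half-suc-double i | half-double i = sum-to-odd g i

  infix 4 _≐_
  _≐_ : Series R → Series R → Set ℓ
  f ≐ g = ∀ m → f m ≈ g m

  ≐-setoid : Setoid c ℓ
  ≐-setoid = record
    { Carrier       = Series R
    ; _≈_           = _≐_
    ; isEquivalence = record
      { refl  = λ m → refl
      ; sym   = λ f≐g m → sym (f≐g m)
      ; trans = λ f≐g g≐h m → trans (f≐g m) (g≐h m)
      }
    }

  module ≐-Reasoning = SetoidReasoning ≐-setoid
  open Setoid ≐-setoid public using () renaming (sym to ≐-sym; trans to ≐-trans)

  AgreeBelow : ℕ → Series R → Series R → Set ℓ
  AgreeBelow m f g = ∀ j → j < m → f j ≈ g j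

  agree-pred : ∀ {m f g} → AgreeBelow (suc m) f g → AgreeBelow m f g
  agree-pred f≈g j j<m = f≈g j (ℕP.m<n⇒m<1+n j<m)

  -- An operator whose degree-m coefficient determines f m once the lower
  -- coefficients of f are known (a "unitriangular" operator) is injective.
  unitriangular-injective : (Φ : Series R → Series R) →
    (∀ {m f g} → AgreeBelow m f g → Φ f m ≈ Φ g m → f m ≈ g m) →
    ∀ {f g} → Φ f ≐ Φ g → f ≐ g
  unitriangular-injective Φ diagonal {f} {g} Φf≐Φg m = agree (suc m) m (ℕP.n<1+n m)
    where
    agree : ∀ m → AgreeBelow m f g
    agree (suc m) j j<1+m with ℕP.m≤n⇒m<n∨m≡n (ℕP.≤-pred j<1+m)
    ... | inj₁ j<m    = agree m j j<m
    ... | inj₂ P.refl = diagonal (agree m) (Φf≐Φg m)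

  infixl 6 _⊕_
  _⊕_ : Series R → Series R → Series R
  (f ⊕ g) m = f m + g m

  scale : Carrier → Series R → Series R
  scale a f m = a * f m

  shift : Series R → Series R
  shift f zero    = 0#
  shift f (suc m) = f m

  shiftBy : ℕ → Series R → Series R
  shiftBy zero    f = f
  shiftBy (suc k) f = shift (shiftBy k f)

  lin : Carrier → Series R → Series R
  lin a f = f ⊕ scale a (shift f)

  ⊕-cong : ∀ {f f′ g g′} → f ≐ f′ → g ≐ g′ → f ⊕ g ≐ f′ ⊕ g′
  ⊕-cong f≐f′ g≐g′ m = +-cong (f≐f′ m) (g≐g′ m)

  shift-cong : ∀ {f g} → f ≐ g → shift f ≐ shift g
  shift-cong f≐g zero    = refl
  shift-cong f≐g (suc m) = f≐g m

  shiftBy-cong : ∀ k {f g} → f ≐ g → shiftBy k f ≐ shiftBy k g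
  shiftBy-cong zero    f≐g = f≐g
  shiftBy-cong (suc k) f≐g = shift-cong (shiftBy-cong k f≐g)

  lin-cong : ∀ a {f g} → f ≐ g → lin a f ≐ lin a g
  lin-cong a f≐g m = +-cong (f≐g m) (*-cong refl (shift-cong f≐g m))

  lin-congˡ : ∀ {a b} f → a ≈ b → lin a f ≐ lin b f
  lin-congˡ f a≈b m = +-cong refl (*-cong a≈b refl)

  shift-⊕ : ∀ f g → shift (f ⊕ g) ≐ shift f ⊕ shift g
  shift-⊕ f g zero    = sym (+-identityʳ 0#)
  shift-⊕ f g (suc m) = refl

  shift-scale : ∀ a f → shift (scale a f) ≐ scale a (shift f)
  shift-scale a f zero    = sym (zeroʳ a)
  shift-scale a f (suc m) = refl

  shiftBy-⊕ : ∀ k f g → shiftBy k (f ⊕ g) ≐ shiftBy k f ⊕ shiftBy k g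
  shiftBy-⊕ zero    f g = λ m → refl
  shiftBy-⊕ (suc k) f g = ≐-trans (shift-cong (shiftBy-⊕ k f g)) (shift-⊕ _ _)

  shiftBy-scale : ∀ k a f → shiftBy k (scale a f) ≐ scale a (shiftBy k f)
  shiftBy-scale zero    a f = λ m → refl
  shiftBy-scale (suc k) a f = ≐-trans (shift-cong (shiftBy-scale k a f)) (shift-scale a _)

  shift-lin : ∀ a f → shift (lin a f) ≐ lin a (shift f)
  shift-lin a f m = trans (shift-⊕ f _ m) (+-cong refl (shift-scale a (shift f) m))

  shiftBy-shift : ∀ k f → shiftBy k (shift f) ≐ shift (shiftBy k f)
  shiftBy-shift zero    f = λ m → refl
  shiftBy-shift (suc k) f = shift-cong (shiftBy-shift k f)

  shiftBy-below : ∀ k f {m} → m < k → shiftBy k f m ≈ 0#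
  shiftBy-below (suc k) f {zero}  _         = refl
  shiftBy-below (suc k) f {suc m} (s≤s m<k) = shiftBy-below k f m<k

  shiftBy-at : ∀ k f m → shiftBy k f (k ℕ.+ m) ≡ f m
  shiftBy-at zero    f m = P.refl
  shiftBy-at (suc k) f m = shiftBy-at k f m

  shift-agree : ∀ {m f g} → AgreeBelow m f g → AgreeBelow (suc m) (shift f) (shift g)
  shift-agree f≈g zero    _         = refl
  shift-agree f≈g (suc j) (s≤s j<m) = f≈g j j<m

  -- Multiplications by linear polynomials commute, and are injective since
  -- the constant term of 1 + a z is 1.
  lin-comm : ∀ a b f → lin a (lin b f) ≐ lin b (lin a f)
  lin-comm a b f m = begin
    lin b f m + a * shift (lin b f) m
      ≈⟨ +-cong refl (*-cong refl (shift-lin b f m)) ⟩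
    (f m + b * shift f m) + a * (shift f m + b * shift (shift f) m)
      ≈⟨ solve 5 (λ x y z a b → (x :+ b :* y) :+ a :* (y :+ b :* z) := (x :+ a :* y) :+ b :* (y :+ a :* z))
               refl (f m) (shift f m) (shift (shift f) m) a b ⟩
    (f m + a * shift f m) + b * (shift f m + a * shift (shift f) m)
      ≈⟨ +-cong refl (*-cong refl (shift-lin a f m)) ⟨
    lin a f m + b * shift (lin a f) m ∎
    where open ≈-Reasoning

  lin-injective : ∀ a {f g} → lin a f ≐ lin a g → f ≐ g
  lin-injective a = unitriangular-injective (lin a) (λ {m} f≈g eq →
    +-cancelʳ eq (*-cong refl (shift-agree f≈g m (ℕP.n<1+n m))))

  lin-at-zero : ∀ a f → lin a f 0 ≈ f 0
  lin-at-zero a f = trans (+-cong refl (zeroʳ a)) (+-identityʳ _)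

  divLin : Carrier → Series R → Series R
  divLin a f zero    = f zero
  divLin a f (suc m) = f (suc m) - a * divLin a f m

  lin-divLin : ∀ a f → lin a (divLin a f) ≐ f
  lin-divLin a f zero    = lin-at-zero a (divLin a f)
  lin-divLin a f (suc m) = solve 3 (λ x a h → (x :- a :* h) :+ a :* h := x) refl (f (suc m)) a (divLin a f m)

  ⊛-onePlus : ∀ f b → _⊛_ R f (onePlus R b) ≐ lin b f
  ⊛-onePlus f b zero    = trans (+-identityˡ _) (trans (*-identityʳ _) (sym (lin-at-zero b f)))
  ⊛-onePlus f b (suc m) = begin
    (sumTo R m term + term m) + term (suc m)
      ≈⟨ +-cong (+-cong (sum-zero m vanishing) (reflexive (P.cong (λ t → f m * onePlus R b t) (ℕP.m+n∸n≡m 1 m))))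
                (reflexive (P.cong (λ t → f (suc m) * onePlus R b t) (ℕP.n∸n≡0 m))) ⟩
    (0# + f m * b) + f (suc m) * 1#
      ≈⟨ solve 3 (λ x y b → (con (+ 0) :+ y :* b) :+ x :* con (+ 1) := x :+ b :* y) refl (f (suc m)) (f m) b ⟩
    f (suc m) + b * f m ∎
    where
    open ≈-Reasoning
    term : ℕ → Carrier
    term i = f i * onePlus R b (suc m ∸ i)
    -- for i < m the exponent  suc m ∸ i = suc (m ∸ i)  is at least 2, where
    -- onePlus vanishes
    vanishing : ∀ i → i < m → term i ≈ 0#
    vanishing i i<m with m ∸ i | ℕP.+-∸-assoc 1 (ℕP.<⇒≤ i<m) | ℕP.m<n⇒0<n∸m i<m
    ... | suc _ | eq | _ = trans (*-cong refl (reflexive (P.cong (onePlus R b) eq))) (zeroʳ (f i))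

  ⊛-invOnePlus : ∀ f a → _⊛_ R f (invOnePlus R a) ≐ divLin a f
  ⊛-invOnePlus f a zero    = trans (+-identityˡ _) (*-identityʳ _)
  ⊛-invOnePlus f a (suc m) = begin
    sumTo R (suc m) term′ + f (suc m) * pow R (- a) (m ∸ m)
      ≈⟨ +-cong (sum-cong (suc m) one-more-factor)
                (reflexive (P.cong (λ t → f (suc m) * pow R (- a) t) (ℕP.n∸n≡0 m))) ⟩
    sumTo R (suc m) (λ i → term i * (- a)) + f (suc m) * 1#
      ≈⟨ +-cong (sum-*ʳ (suc m) term (- a)) refl ⟨
    sumTo R (suc m) term * (- a) + f (suc m) * 1#
      ≈⟨ +-cong (*-cong (⊛-invOnePlus f a m) refl) refl ⟩
    divLin a f m * (- a) + f (suc m) * 1#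
      ≈⟨ solve 3 (λ h a x → h :* (:- a) :+ x :* con (+ 1) := x :- a :* h) refl (divLin a f m) a (f (suc m)) ⟩
    divLin a f (suc m) ∎
    where
    open ≈-Reasoning
    term term′ : ℕ → Carrier
    term  i = f i * pow R (- a) (m ∸ i)
    term′ i = f i * pow R (- a) (suc m ∸ i)
    one-more-factor : ∀ i → i < suc m → term′ i ≈ term i * (- a)
    one-more-factor i i<1+m = trans
      (reflexive (P.cong (λ t → f i * pow R (- a) t) (ℕP.+-∸-assoc 1 (ℕP.≤-pred i<1+m))))
      (sym (*-assoc _ _ _))

  -- The substitution  z ↦ q z,  i.e. f(qz).
  module _ (q : Carrier) where
    dil : Series R → Series R
    dil f m = pow R q m * f m

    dil-cong : ∀ {f g} → f ≐ g → dil f ≐ dil g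
    dil-cong f≐g m = *-cong refl (f≐g m)

    dil-⊕ : ∀ f g → dil (f ⊕ g) ≐ dil f ⊕ dil g
    dil-⊕ f g m = distribˡ _ _ _

    dil-agree : ∀ {m f g} → AgreeBelow m f g → AgreeBelow m (dil f) (dil g)
    dil-agree f≈g j j<m = *-cong refl (f≈g j j<m)

    dil-shift : ∀ f → dil (shift f) ≐ scale q (shift (dil f))
    dil-shift f zero    = trans (zeroʳ _) (sym (zeroʳ q))
    dil-shift f (suc m) = solve 3 (λ p q x → (p :* q) :* x := q :* (p :* x)) refl (pow R q m) q (f m)

    dil-lin : ∀ b f → dil (lin b f) ≐ lin (b * q) (dil f)
    dil-lin b f m = begin
      pow R q m * (f m + b * shift f m)
        ≈⟨ solve 4 (λ p x b y → p :* (x :+ b :* y) := p :* x :+ b :* (p :* y)) refl (pow R q m) (f m) b (shift f m) ⟩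
      pow R q m * f m + b * dil (shift f) m
        ≈⟨ +-cong refl (*-cong refl (dil-shift f m)) ⟩
      pow R q m * f m + b * (q * shift (dil f) m)
        ≈⟨ +-cong refl (sym (*-assoc b q _)) ⟩
      lin (b * q) (dil f) m ∎
      where open ≈-Reasoning

    -- The operator of the functional equation,
    --   Lop c f = (1 + q z) f + c z² (1 + z) f(qz)  =  f + LopTail c f;
    -- for c = q it is the equation satisfied by both sides of the key identity.
    LopTail : Carrier → Series R → Series R
    LopTail c f = scale q (shift f) ⊕ scale c (lin 1# (shiftBy 2 (dil f)))

    Lop : Carrier → Series R → Series R
    Lop c f = f ⊕ LopTail c f

    LopTail-agree : ∀ c {m f g} → AgreeBelow m f g → LopTail c f m ≈ LopTail c g m
    LopTail-agree c {m} f≈g = +-cong (*-cong refl (shift-at f≈g))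
      (*-cong refl (+-cong (shift-at (shift-below (dil-agree f≈g)))
                            (*-cong refl (shift-at (shift-below (shift-below (dil-agree f≈g)))))))
      where
      shift-at : ∀ {f g} → AgreeBelow m f g → shift f m ≈ shift g m
      shift-at f≈g = shift-agree f≈g m (ℕP.n<1+n m)
      shift-below : ∀ {f g} → AgreeBelow m f g → AgreeBelow m (shift f) (shift g)
      shift-below f≈g = agree-pred (shift-agree f≈g)

    Lop-local : ∀ c {m f g} → AgreeBelow (suc m) f g → Lop c f m ≈ Lop c g m
    Lop-local c {m} f≈g = +-cong (f≈g m (ℕP.n<1+n m)) (LopTail-agree c (agree-pred f≈g))

    Lop-cong : ∀ c {f g} → f ≐ g → Lop c f ≐ Lop c g
    Lop-cong c f≐g m = Lop-local c (λ j _ → f≐g j)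

    Lop-congˡ : ∀ {c c′} f → c ≈ c′ → Lop c f ≐ Lop c′ f
    Lop-congˡ f c≈c′ m = +-cong refl (+-cong refl (*-cong c≈c′ refl))

    Lop-injective : ∀ c {f g} → Lop c f ≐ Lop c g → f ≐ g
    Lop-injective c = unitriangular-injective (Lop c) (λ f≈g eq → +-cancelʳ eq (LopTail-agree c f≈g))

    Lop-⊕ : ∀ c f g → Lop c (f ⊕ g) ≐ Lop c f ⊕ Lop c g
    Lop-⊕ c f g m = begin
      (f m + g m) + (q * shift (f ⊕ g) m + c * (shiftBy 2 d m + 1# * shiftBy 3 d m))
        ≈⟨ +-cong refl (+-cong (*-cong refl (shift-⊕ f g m))
                                (*-cong refl (+-cong (split 2) (*-cong refl (split 3))))) ⟩
      (f m + g m) + (q * (shift f m + shift g m)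
                      + c * ((shiftBy 2 df m + shiftBy 2 dg m) + 1# * (shiftBy 3 df m + shiftBy 3 dg m)))
        ≈⟨ solve 10 (λ x y x₁ y₁ x₂ y₂ x₃ y₃ q c →
               (x :+ y) :+ (q :* (x₁ :+ y₁) :+ c :* ((x₂ :+ y₂) :+ con (+ 1) :* (x₃ :+ y₃)))
            := (x :+ (q :* x₁ :+ c :* (x₂ :+ con (+ 1) :* x₃))) :+ (y :+ (q :* y₁ :+ c :* (y₂ :+ con (+ 1) :* y₃))))
            refl (f m) (g m) (shift f m) (shift g m) (shiftBy 2 df m) (shiftBy 2 dg m)
                 (shiftBy 3 df m) (shiftBy 3 dg m) q c ⟩
      Lop c f m + Lop c g m ∎
      where
      open ≈-Reasoning
      d df dg : Series R
      d  = dil (f ⊕ g)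
      df = dil f
      dg = dil g
      split : ∀ k → shiftBy k d m ≈ shiftBy k df m + shiftBy k dg m
      split k = trans (shiftBy-cong k (dil-⊕ f g) m) (shiftBy-⊕ k df dg m)

    -- Lop c (z f) = z · Lop (c q) f : multiplying by z rescales the
    -- dilated part by q.
    Lop-shift : ∀ c f → Lop c (shift f) ≐ shift (Lop (c * q) f)
    Lop-shift c f m = begin
      shift f m + (q * shift (shift f) m + c * (shiftBy 2 (dil (shift f)) m + 1# * shiftBy 3 (dil (shift f)) m))
        ≈⟨ +-cong refl (+-cong refl (*-cong refl (+-cong (dilated 2) (*-cong refl (dilated 3))))) ⟩
      shift f m + (q * shiftBy 2 f m + c * (q * shiftBy 3 d m + 1# * (q * shiftBy 4 d m)))
        ≈⟨ +-cong refl (+-cong refl (solve 4 (λ c q x y →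
               c :* (q :* x :+ con (+ 1) :* (q :* y)) := (c :* q) :* (x :+ con (+ 1) :* y))
             refl c q (shiftBy 3 d m) (shiftBy 4 d m))) ⟩
      shift f m + (q * shiftBy 2 f m + (c * q) * (shiftBy 3 d m + 1# * shiftBy 4 d m))
        ≈⟨ +-cong refl (trans (shift-⊕ _ _ m) (+-cong (shift-scale q (shift f) m)
                                                       (trans (shift-scale (c * q) _ m) (*-cong refl (shift-lin 1# _ m))))) ⟨
      shift f m + shift (LopTail (c * q) f) m
        ≈⟨ shift-⊕ f (LopTail (c * q) f) m ⟨
      shift (Lop (c * q) f) m ∎
      where
      open ≈-Reasoning
      d : Series R
      d = dil f
      dilated : ∀ k → shiftBy k (dil (shift f)) m ≈ q * shiftBy (suc k) d m
      dilated k = trans (shiftBy-cong k (dil-shift f) m)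
                        (trans (shiftBy-scale k q (shift d) m) (*-cong refl (shiftBy-shift k d m)))

    Lop-shiftBy : ∀ k c f → Lop c (shiftBy k f) ≐ shiftBy k (Lop (c * pow R q k) f)
    Lop-shiftBy zero    c f = Lop-congˡ f (sym (*-identityʳ c))
    Lop-shiftBy (suc k) c f = begin
      Lop c (shift (shiftBy k f))                 ≈⟨ Lop-shift c (shiftBy k f) ⟩
      shift (Lop (c * q) (shiftBy k f))           ≈⟨ shift-cong (Lop-shiftBy k (c * q) f) ⟩
      shift (shiftBy k (Lop (c * q * pow R q k) f)) ≈⟨ shift-cong (shiftBy-cong k (Lop-congˡ f reorder)) ⟩
      shift (shiftBy k (Lop (c * pow R q (suc k)) f)) ∎
      where
      open ≐-Reasoning
      reorder : c * q * pow R q k ≈ c * (pow R q k * q)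
      reorder = solve 3 (λ c q p → c :* q :* p := c :* (p :* q)) refl c q (pow R q k)

    F : ℕ → Series R
    F = qQuot R q

    F-rec : ∀ n → lin (pow R q (suc n)) (F (suc n)) ≐ lin (- pow R q n) (F n)
    F-rec n = begin
      lin (pow R q (suc n)) (F (suc n))
        ≈⟨ lin-cong _ (⊛-invOnePlus _ (pow R q (suc n))) ⟩
      lin (pow R q (suc n)) (divLin (pow R q (suc n)) (_⊛_ R (F n) (onePlus R (- pow R q n))))
        ≈⟨ lin-divLin _ _ ⟩
      _⊛_ R (F n) (onePlus R (- pow R q n))
        ≈⟨ ⊛-onePlus (F n) _ ⟩
      lin (- pow R q n) (F n) ∎
      where open ≐-Reasoning

    F-at-zero : ∀ n → F n 0 ≈ 1#
    F-at-zero zero    = refl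
    F-at-zero (suc n) = begin
      F (suc n) 0                           ≈⟨ lin-at-zero _ (F (suc n)) ⟨
      lin (pow R q (suc n)) (F (suc n)) 0   ≈⟨ F-rec n 0 ⟩
      lin (- pow R q n) (F n) 0             ≈⟨ lin-at-zero _ (F n) ⟩
      F n 0                                 ≈⟨ F-at-zero n ⟩
      1#                                    ∎
      where open ≈-Reasoning

    dil-F0 : dil (F 0) ≐ F 0
    dil-F0 zero    = *-identityˡ 1#
    dil-F0 (suc m) = zeroʳ _

    dil-F-rec : ∀ n → lin (pow R q (suc (suc n))) (dil (F (suc n))) ≐ lin (- pow R q (suc n)) (dil (F n))
    dil-F-rec n = begin
      lin (pow R q (suc n) * q) (dil (F (suc n)))   ≈⟨ dil-lin _ (F (suc n)) ⟨
      dil (lin (pow R q (suc n)) (F (suc n)))       ≈⟨ dil-cong (F-rec n) ⟩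
      dil (lin (- pow R q n) (F n))                 ≈⟨ dil-lin _ (F n) ⟩
      lin (- pow R q n * q) (dil (F n))             ≈⟨ lin-congˡ _ (sym (-‿distribˡ-* _ q)) ⟩
      lin (- pow R q (suc n)) (dil (F n))           ∎
      where open ≐-Reasoning

    -- The second recurrence  (1 + q z) F (n+1) (z) = (1 - z) F n (qz),
    -- obtained by induction after cancelling the factor 1 + q^(n+2) z.
    F-dil-rec : ∀ n → lin q (F (suc n)) ≐ lin (- 1#) (dil (F n))
    F-dil-rec zero = begin
      lin q (F 1)                   ≈⟨ lin-congˡ (F 1) (sym (*-identityˡ q)) ⟩
      lin (pow R q 1) (F 1)         ≈⟨ F-rec 0 ⟩
      lin (- 1#) (F 0)              ≈⟨ lin-cong (- 1#) dil-F0 ⟨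
      lin (- 1#) (dil (F 0))        ∎
      where open ≐-Reasoning
    F-dil-rec (suc n) = lin-injective P₂ (begin
      lin P₂ (lin q F₂)                  ≈⟨ lin-comm P₂ q F₂ ⟩
      lin q (lin P₂ F₂)                  ≈⟨ lin-cong q (F-rec (suc n)) ⟩
      lin q (lin (- P₁) F₁)              ≈⟨ lin-comm q (- P₁) F₁ ⟩
      lin (- P₁) (lin q F₁)              ≈⟨ lin-cong (- P₁) (F-dil-rec n) ⟩
      lin (- P₁) (lin (- 1#) (dil F₀))   ≈⟨ lin-comm (- P₁) (- 1#) (dil F₀) ⟩
      lin (- 1#) (lin (- P₁) (dil F₀))   ≈⟨ lin-cong (- 1#) (dil-F-rec n) ⟨
      lin (- 1#) (lin P₂ (dil F₁))       ≈⟨ lin-comm (- 1#) P₂ (dil F₁) ⟩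
      lin P₂ (lin (- 1#) (dil F₁))       ∎)
      where
      open ≐-Reasoning
      P₁ P₂ : Carrier
      P₁ = pow R q (suc n)
      P₂ = pow R q (suc (suc n))
      F₀ F₁ F₂ : Series R
      F₀ = F n
      F₁ = F (suc n)
      F₂ = F (suc (suc n))

    -- The telescoping terms: with  summand n = z^n F n  one has
    --   Lop q (summand n) = remainder n - remainder (n+1),
    -- where  remainder 0 = (1 + z)(1 + q z)  and
    --   remainder (n+1) = z^(n+1) (1 - q^(n+1) z²) F n (qz).
    boundary : ℕ → Series R
    boundary n = dil (F n) ⊕ scale (- pow R q (suc n)) (shiftBy 2 (dil (F n)))

    summand remainder : ℕ → Series R
    summand n = shiftBy n (F n)
    remainder zero    = lin 1# (lin q (F 0))
    remainder (suc n) = shiftBy (suc n) (boundary n)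

    shift-boundary : ∀ n m →
      shift (boundary n) m ≈ shift (dil (F n)) m + (- pow R q (suc n)) * shiftBy 3 (dil (F n)) m
    shift-boundary n m = trans (shift-⊕ _ _ m) (+-cong refl (shift-scale _ _ m))

    -- The heart of the telescoping, before multiplication by z^(n+1):
    -- it combines the two recurrences for F.
    boundary-rec : ∀ n → Lop (pow R q (suc (suc n))) (F (suc n)) ⊕ shift (boundary (suc n)) ≐ boundary n
    boundary-rec n m = begin
      (F₁ m + (q * shift F₁ m + (P * q) * (shiftBy 2 d₁ m + 1# * shiftBy 3 d₁ m)))
        + shift (boundary (suc n)) m
        ≈⟨ +-cong refl (shift-boundary (suc n) m) ⟩
      (F₁ m + (q * shift F₁ m + (P * q) * (shiftBy 2 d₁ m + 1# * shiftBy 3 d₁ m)))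
        + (shift d₁ m + (- (P * q)) * shiftBy 3 d₁ m)
        ≈⟨ solve 7 (λ x x₁ y₁ y₂ y₃ p q →
               (x :+ (q :* x₁ :+ (p :* q) :* (y₂ :+ con (+ 1) :* y₃))) :+ (y₁ :+ (:- (p :* q)) :* y₃)
            := (x :+ q :* x₁) :+ (y₁ :+ (p :* q) :* y₂))
            refl (F₁ m) (shift F₁ m) (shift d₁ m) (shiftBy 2 d₁ m) (shiftBy 3 d₁ m) P q ⟩
      lin q F₁ m + lin (P * q) (shift d₁) m
        ≈⟨ +-cong (F-dil-rec n m) (trans (sym (shift-lin _ d₁ m)) (trans (shift-cong (dil-F-rec n) m) (shift-lin _ d₀ m))) ⟩
      lin (- 1#) d₀ m + lin (- P) (shift d₀) m
        ≈⟨ solve 4 (λ y y₁ y₂ p → (y :+ (:- con (+ 1)) :* y₁) :+ (y₁ :+ (:- p) :* y₂) := y :+ (:- p) :* y₂)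
            refl (d₀ m) (shift d₀ m) (shiftBy 2 d₀ m) P ⟩
      boundary n m ∎
      where
      open ≈-Reasoning
      P : Carrier
      P = pow R q (suc n)
      F₁ d₀ d₁ : Series R
      F₁ = F (suc n)
      d₀ = dil (F n)
      d₁ = dil (F (suc n))

    telescope-step : ∀ n → Lop q (summand n) ⊕ remainder (suc n) ≐ remainder n
    telescope-step zero m = begin
      (F0 m + (q * shift F0 m + q * (shiftBy 2 (dil F0) m + 1# * shiftBy 3 (dil F0) m)))
        + shift (boundary 0) m
        ≈⟨ +-cong (+-cong refl (+-cong refl (*-cong refl (+-cong (undilate 2) (*-cong refl (undilate 3))))))
                  (trans (shift-boundary 0 m) (+-cong (undilate 1) (*-cong refl (undilate 3)))) ⟩
      (F0 m + (q * shift F0 m + q * (shiftBy 2 F0 m + 1# * shiftBy 3 F0 m)))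
        + (shift F0 m + (- (1# * q)) * shiftBy 3 F0 m)
        ≈⟨ solve 5 (λ x x₁ x₂ x₃ q →
               (x :+ (q :* x₁ :+ q :* (x₂ :+ con (+ 1) :* x₃))) :+ (x₁ :+ (:- (con (+ 1) :* q)) :* x₃)
            := (x :+ q :* x₁) :+ con (+ 1) :* (x₁ :+ q :* x₂))
            refl (F0 m) (shift F0 m) (shiftBy 2 F0 m) (shiftBy 3 F0 m) q ⟩
      lin q F0 m + 1# * lin q (shift F0) m
        ≈⟨ +-cong refl (*-cong refl (shift-lin q F0 m)) ⟨
      remainder 0 m ∎
      where
      open ≈-Reasoning
      F0 : Series R
      F0 = F 0
      undilate : ∀ k → shiftBy k (dil F0) m ≈ shiftBy k F0 m
      undilate k = shiftBy-cong k dil-F0 m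
    telescope-step (suc n) = begin
      Lop q (shiftBy (suc n) (F (suc n))) ⊕ shift (shiftBy (suc n) (boundary (suc n)))
        ≈⟨ ⊕-cong (Lop-shiftBy (suc n) q (F (suc n))) (≐-sym (shiftBy-shift (suc n) (boundary (suc n)))) ⟩
      shiftBy (suc n) (Lop (q * pow R q (suc n)) (F (suc n))) ⊕ shiftBy (suc n) (shift (boundary (suc n)))
        ≈⟨ ≐-sym (shiftBy-⊕ (suc n) _ _) ⟩
      shiftBy (suc n) (Lop (q * pow R q (suc n)) (F (suc n)) ⊕ shift (boundary (suc n)))
        ≈⟨ shiftBy-cong (suc n) (⊕-cong (Lop-congˡ (F (suc n)) (*-comm q _)) (λ m → refl)) ⟩
      shiftBy (suc n) (Lop (pow R q (suc (suc n))) (F (suc n)) ⊕ shift (boundary (suc n)))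
        ≈⟨ shiftBy-cong (suc n) (boundary-rec n) ⟩
      shiftBy (suc n) (boundary n) ∎
      where open ≐-Reasoning

    partial : ℕ → Series R
    partial N m = sumTo R (suc N) (λ n → summand n m)

    G : Series R
    G m = sumTo R (suc m) (λ n → F n (m ∸ n))

    telescope : ∀ N → Lop q (partial N) ⊕ remainder (suc N) ≐ remainder 0
    telescope zero = ≐-trans (⊕-cong (Lop-cong q (λ m → +-identityˡ _)) (λ m → refl)) (telescope-step 0)
    telescope (suc N) = begin
      Lop q (partial N ⊕ summand (suc N)) ⊕ remainder (suc (suc N))
        ≈⟨ ⊕-cong (Lop-⊕ q (partial N) (summand (suc N))) (λ m → refl) ⟩
      (Lop q (partial N) ⊕ Lop q (summand (suc N))) ⊕ remainder (suc (suc N))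
        ≈⟨ (λ m → +-assoc _ _ _) ⟩
      Lop q (partial N) ⊕ (Lop q (summand (suc N)) ⊕ remainder (suc (suc N)))
        ≈⟨ ⊕-cong (λ m → refl) (telescope-step (suc N)) ⟩
      Lop q (partial N) ⊕ remainder (suc N)
        ≈⟨ telescope N ⟩
      remainder 0 ∎
      where open ≐-Reasoning

    partial-agree : ∀ N {j} → j ≤ N → partial N j ≈ G j
    partial-agree N {j} j≤N with ℕP.m≤n⇒m<n∨m≡n j≤N
    ... | inj₂ P.refl = sum-cong (suc j) (λ n n<1+j → summand-at (ℕP.≤-pred n<1+j))
      where
      summand-at : ∀ {n} → n ≤ j → summand n j ≈ F n (j ∸ n)
      summand-at {n} n≤j = reflexive (P.trans (P.cong (summand n) (P.sym (ℕP.m+[n∸m]≡n n≤j)))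
                                               (shiftBy-at n (F n) (j ∸ n)))
    ... | inj₁ (s≤s j≤N′) = trans (+-cong (partial-agree _ j≤N′) (shiftBy-below _ _ (s≤s j≤N′)))
                                  (+-identityʳ _)

    G-equation : Lop q G ≐ remainder 0
    G-equation m = begin
      Lop q G m                                     ≈⟨ Lop-local q (λ j j<1+m → sym (partial-agree m (ℕP.≤-pred j<1+m))) ⟩
      Lop q (partial m) m                           ≈⟨ +-identityʳ _ ⟨
      Lop q (partial m) m + 0#                      ≈⟨ +-cong refl (shiftBy-below (suc m) _ (ℕP.n<1+n m)) ⟨
      Lop q (partial m) m + remainder (suc m) m     ≈⟨ telescope m m ⟩
      remainder 0 m                                 ∎
      where open ≈-Reasoning

    e : ℕ → Carrier
    e k = pow R (- 1#) k * pow R q (k ℕ.* k)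

    C : Series R
    C m = e ⌊ m /2⌋

    C-even : ∀ i → C (2 ℕ.* i) ≡ e i
    C-even i = P.cong e (half-double i)

    C-odd : ∀ i → C (suc (2 ℕ.* i)) ≡ e i
    C-odd i = P.cong e (half-suc-double i)

    pow-+ : ∀ x m n → pow R x (m ℕ.+ n) ≈ pow R x m * pow R x n
    pow-+ x zero    n = sym (*-identityˡ _)
    pow-+ x (suc m) n = trans (*-cong (pow-+ x m n) refl)
      (solve 3 (λ a b x → (a :* b) :* x := (a :* x) :* b) refl (pow R x m) (pow R x n) x)

    e-step : ∀ i → e (suc i) + pow R q (suc (2 ℕ.* i)) * e i ≈ 0#
    e-step i = begin
      (s * - 1#) * pow R q (suc i ℕ.* suc i) + p * (s * t)
        ≈⟨ +-cong (*-cong refl (trans (reflexive (P.cong (pow R q) (square-suc i))) (pow-+ q (i ℕ.* i) _))) refl ⟩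
      (s * - 1#) * (t * p) + p * (s * t)
        ≈⟨ solve 3 (λ s t p → (s :* (:- con (+ 1))) :* (t :* p) :+ p :* (s :* t) := con (+ 0)) refl s t p ⟩
      0# ∎
      where
      open ≈-Reasoning
      s t p : Carrier
      s = pow R (- 1#) i
      t = pow R q (i ℕ.* i)
      p = pow R q (suc (2 ℕ.* i))

    -- The coefficient of z^(j+3) in  Lop q f,  in terms of f j, …, f (j+3).
    high-coefficient : ℕ → (x₀ x₁ x₂ x₃ : Carrier) → Carrier
    high-coefficient j x₀ x₁ x₂ x₃ = x₃ + (q * x₂ + q * (pow R q (suc j) * x₁ + 1# * (pow R q j * x₀)))

    high-coefficient-cong : ∀ j {x₀ x₁ x₂ x₃ y₀ y₁ y₂ y₃} →
      x₀ ≡ y₀ → x₁ ≡ y₁ → x₂ ≡ y₂ → x₃ ≡ y₃ → high-coefficient j x₀ x₁ x₂ x₃ ≈ high-coefficient j y₀ y₁ y₂ y₃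
    high-coefficient-cong j P.refl P.refl P.refl P.refl = refl

    -- Above degree 2 the coefficients of  Lop q C  vanish: the terms pair up
    -- into multiples of e-step.
    Lop-C-high : ∀ j → Lop q C (suc (suc (suc j))) ≈ 0#
    Lop-C-high j with evenOdd j
    ... | even i = begin
      Lop q C (suc (suc (suc (2 ℕ.* i))))
        ≈⟨ high-coefficient-cong (2 ℕ.* i) (C-even i) (C-odd i) (P.cong (λ k → e (suc k)) (half-double i))
                                   (P.cong (λ k → e (suc k)) (half-suc-double i)) ⟩
      high-coefficient (2 ℕ.* i) (e i) (e i) (e (suc i)) (e (suc i))
        ≈⟨ solve 4 (λ e₀ e₁ p q →
               e₁ :+ (q :* e₁ :+ q :* ((p :* q) :* e₀ :+ con (+ 1) :* (p :* e₀)))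
            := (con (+ 1) :+ q) :* (e₁ :+ (p :* q) :* e₀))
            refl (e i) (e (suc i)) (pow R q (2 ℕ.* i)) q ⟩
      (1# + q) * (e (suc i) + pow R q (suc (2 ℕ.* i)) * e i)
        ≈⟨ trans (*-cong refl (e-step i)) (zeroʳ _) ⟩
      0# ∎
      where open ≈-Reasoning
    ... | odd i = begin
      Lop q C (suc (suc (suc (suc (2 ℕ.* i)))))
        ≈⟨ high-coefficient-cong (suc (2 ℕ.* i)) (C-odd i) (P.cong (λ k → e (suc k)) (half-double i))
                                   (P.cong (λ k → e (suc k)) (half-suc-double i))
                                   (P.cong (λ k → e (suc (suc k))) (half-double i)) ⟩
      high-coefficient (suc (2 ℕ.* i)) (e i) (e (suc i)) (e (suc i)) (e (suc (suc i)))
        ≈⟨ solve 5 (λ e₀ e₁ e₂ p q →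
               e₂ :+ (q :* e₁ :+ q :* (((p :* q) :* q) :* e₁ :+ con (+ 1) :* ((p :* q) :* e₀)))
            := (e₂ :+ (((p :* q) :* q) :* q) :* e₁) :+ q :* (e₁ :+ (p :* q) :* e₀))
            refl (e i) (e (suc i)) (e (suc (suc i))) (pow R q (2 ℕ.* i)) q ⟩
      (e (suc (suc i)) + pow R q (suc (suc (suc (2 ℕ.* i)))) * e (suc i))
        + q * (e (suc i) + pow R q (suc (2 ℕ.* i)) * e i)
        ≈⟨ +-cong e-step-suc (*-cong refl (e-step i)) ⟩
      0# + q * 0#
        ≈⟨ trans (+-identityˡ _) (zeroʳ q) ⟩
      0# ∎
      where
      open ≈-Reasoning
      e-step-suc : e (suc (suc i)) + pow R q (suc (suc (suc (2 ℕ.* i)))) * e (suc i) ≈ 0#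
      e-step-suc = trans (+-cong refl (*-cong (reflexive (P.cong (λ k → pow R q (suc k)) (P.sym (double-suc i)))) refl))
                         (e-step (suc i))

    C-equation : Lop q C ≐ remainder 0
    C-equation zero = solve 1 (λ q →
        con (+ 1) :* con (+ 1) :+ (q :* con (+ 0) :+ q :* (con (+ 0) :+ con (+ 1) :* con (+ 0)))
      := (con (+ 1) :+ q :* con (+ 0)) :+ con (+ 1) :* con (+ 0)) refl q
    C-equation (suc zero) = solve 1 (λ q →
        con (+ 1) :* con (+ 1) :+ (q :* (con (+ 1) :* con (+ 1)) :+ q :* (con (+ 0) :+ con (+ 1) :* con (+ 0)))
      := (con (+ 0) :+ q :* con (+ 1)) :+ con (+ 1) :* (con (+ 1) :+ q :* con (+ 0))) refl q
    C-equation (suc (suc zero)) = solve 1 (λ q →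
        (con (+ 1) :* (:- con (+ 1))) :* (con (+ 1) :* q)
          :+ (q :* (con (+ 1) :* con (+ 1)) :+ q :* (con (+ 1) :* (con (+ 1) :* con (+ 1)) :+ con (+ 1) :* con (+ 0)))
      := (con (+ 0) :+ q :* con (+ 0)) :+ con (+ 1) :* (con (+ 0) :+ q :* con (+ 1))) refl q
    C-equation (suc (suc (suc j))) = trans (Lop-C-high j)
      (solve 1 (λ q → con (+ 0) := (con (+ 0) :+ q :* con (+ 0)) :+ con (+ 1) :* (con (+ 0) :+ q :* con (+ 0))) refl q)

    G≐C : G ≐ C
    G≐C = Lop-injective q (≐-trans G-equation (≐-sym C-equation))

    -- The coefficient of z^m in  Σ_n u n z^n F n.  Since every F n has
    -- constant term 1 this is a unitriangular operator on u.
    weighted : Series R → Series R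
    weighted u m = sumTo R (suc m) (λ n → u n * F n (m ∸ n))

    weighted-injective : ∀ {u v} → weighted u ≐ weighted v → u ≐ v
    weighted-injective = unitriangular-injective weighted diagonal
      where
      F-diagonal : ∀ m → F m (m ∸ m) ≈ 1#
      F-diagonal m = trans (reflexive (P.cong (F m) (ℕP.n∸n≡0 m))) (F-at-zero m)
      diagonal : ∀ {m u v} → AgreeBelow m u v → weighted u m ≈ weighted v m → u m ≈ v m
      diagonal {m} {u} {v} u≈v eq = begin
        u m                      ≈⟨ trans (*-cong refl (F-diagonal m)) (*-identityʳ _) ⟨
        u m * F m (m ∸ m)        ≈⟨ +-cancelˡ eq (sum-cong m (λ n n<m → *-cong (u≈v n n<m) refl)) ⟩
        v m * F m (m ∸ m)        ≈⟨ trans (*-cong refl (F-diagonal m)) (*-identityʳ _) ⟩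
        v m                      ∎
        where open ≈-Reasoning

    module _ (B : ℕ → ℕ → Carrier) (isB : IsBExpansion R q B) where
      u : Series R
      u n = sumTo R (suc n) (λ k → B n k * C k)

      -- Substituting  z^k = Σ_n B n k z^n F n  into  C = Σ_k C k z^k.
      weighted-u : weighted u ≐ C
      weighted-u m = begin
        sumTo R (suc m) (λ n → u n * F n (m ∸ n))
          ≈⟨ sum-cong (suc m) (λ n _ → sum-*ʳ (suc n) _ (F n (m ∸ n))) ⟩
        sumTo R (suc m) (λ n → sumTo R (suc n) (λ k → (B n k * C k) * F n (m ∸ n)))
          ≈⟨ sum-triangle (suc m) (λ n k → (B n k * C k) * F n (m ∸ n)) ⟩
        sumTo R (suc m) (λ k → sumTo R (suc m ∸ k) (λ i → (B (k ℕ.+ i) k * C k) * F (k ℕ.+ i) (m ∸ (k ℕ.+ i))))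
          ≈⟨ sum-cong (suc m) (λ k _ → trans (sum-cong (suc m ∸ k) (λ i _ → reorder _ _ _))
                                             (sym (sum-*ʳ (suc m ∸ k) _ (C k)))) ⟩
        sumTo R (suc m) (λ k → sumTo R (suc m ∸ k) (λ i → B (k ℕ.+ i) k * F (k ℕ.+ i) (m ∸ (k ℕ.+ i))) * C k)
          ≈⟨ sum-cong (suc m) (λ k _ → *-cong (isB k m) refl) ⟨
        sumTo R (suc m) (λ k → δ R m k * C k)
          ≈⟨ sum-δ m C ⟩
        C m ∎
        where
        open ≈-Reasoning
        reorder : ∀ b x f → (b * x) * f ≈ (b * f) * x
        reorder = solve 3 (λ b x f → (b :* x) :* f := (b :* f) :* x) refl

      -- Both  u  and the constant sequence 1 solve the same unitriangular system.
      u≐1 : u ≐ (λ _ → 1#)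
      u≐1 = weighted-injective (≐-trans weighted-u (≐-trans (≐-sym G≐C) (λ m → sum-cong (suc m) (λ n _ → sym (*-identityˡ _)))))

      corLHS≈u : ∀ n → corLHS R q B n ≈ u n
      corLHS≈u n = sym (trans (sum-even-odd n (λ k → B n k * C k))
        (+-cong (sum-cong (suc ⌊ n /2⌋) (λ k _ → *-cong refl (reflexive (C-even k))))
                (sum-cong ⌈ n /2⌉ (λ k _ → *-cong refl (reflexive (C-odd k))))))

corollary3p5 : ∀ {c ℓ : Level} (R : CommutativeRing c ℓ) (q : CommutativeRing.Carrier R)
    (B : ℕ → ℕ → CommutativeRing.Carrier R) → IsBExpansion R q B →
    ∀ (n : ℕ) → CommutativeRing._≈_ R (corLHS R q B n) (CommutativeRing.1# R)
corollary3p5 R q B isB n = CommutativeRing.trans R (corLHS≈u R q B isB n) (u≐1 R q B isB n)
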